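{- Let $Q$ be a finite (left) quasifield with $q$ elements and let $A,B,C,D\subset Q$. If $\gamma\in Q$ and $N_\gamma(A,B,C,D)$ is the number of solutions to $a + b + \gamma = c\cdot d$ with $a\in A$, $b\in B$, $c\in C$, $d\in D$, then \[ \left| N_\gamma(A,B,C,D) - \frac{(q+1)|A||B||C||D|}{q^2+q+1}\right| \leq q^{1/2}\sqrt{|A||B||C||D|}. \]
   Context: A (left) quasifield is a set $Q$ with two binary operations $+$ and $\cdot$ such that $(Q,+)$ is a group with identity $0$; $(Q\setminus\{0\},\cdot)$ is a loop (for all $a,b$ the equations $a\cdot x=b$ and $y\cdot a=b$ have unique solutions, and there is an identity $1$); $a\cdot(b+c)=a\cdot b+a\cdot c$ for all $a,b,c$; $0\cdot x=0$ for all $x$; and for $a\neq b$ the equation $a\cdot x=b\cdot x+c$ has exactly one solution $x$. -}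

module Defs where

open import Data.Nat using (ℕ; zero; suc; _+_; _*_; _≤_)
open import Data.Fin using (Fin)
open import Data.Fin.Properties using (_≟_)
open import Data.Fin.Subset using (Subset; ∣_∣)
open import Data.Bool using (Bool; true; false; _∧_; if_then_else_)
open import Data.Vec using (lookup)
open import Data.Product using (Σ; _×_)
open import Relation.Binary.PropositionalEquality using (_≡_; _≢_)
open import Relation.Nullary.Decidable using (⌊_⌋)
open import Algebra.Structures using (IsGroup)


record IsQuasifield (q : ℕ) (_⊕_ _⊙_ : Fin q → Fin q → Fin q)
                    (⊖_ : Fin q → Fin q) (𝟘 𝟙 : Fin q) : Set where
  field
    +-isGroup  : IsGroup _≡_ _⊕_ 𝟘 ⊖_
    ·-closed   : ∀ a b → a ≢ 𝟘 → b ≢ 𝟘 → (a ⊙ b) ≢ 𝟘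
    𝟙≢𝟘        : 𝟙 ≢ 𝟘
    ·-identityˡ : ∀ x → x ≢ 𝟘 → 𝟙 ⊙ x ≡ x
    ·-identityʳ : ∀ x → x ≢ 𝟘 → x ⊙ 𝟙 ≡ x
    ·-leftDiv  : ∀ a b → a ≢ 𝟘 → b ≢ 𝟘 →
                 Σ (Fin q) λ x → x ≢ 𝟘 × a ⊙ x ≡ b ×
                   (∀ x' → x' ≢ 𝟘 → a ⊙ x' ≡ b → x' ≡ x)
    ·-rightDiv : ∀ a b → a ≢ 𝟘 → b ≢ 𝟘 →
                 Σ (Fin q) λ y → y ≢ 𝟘 × y ⊙ a ≡ b ×
                   (∀ y' → y' ≢ 𝟘 → y' ⊙ a ≡ b → y' ≡ y)
    distribˡ   : ∀ a b c → a ⊙ (b ⊕ c) ≡ (a ⊙ b) ⊕ (a ⊙ c)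
    zeroˡ      : ∀ x → 𝟘 ⊙ x ≡ 𝟘
    uniqueSol  : ∀ a b c → a ≢ b →
                 Σ (Fin q) λ x → a ⊙ x ≡ (b ⊙ x) ⊕ c ×
                   (∀ x' → a ⊙ x' ≡ (b ⊙ x') ⊕ c → x' ≡ x)

record FiniteQuasifield (q : ℕ) : Set where
  field
    _⊕_ _⊙_ : Fin q → Fin q → Fin q
    ⊖_      : Fin q → Fin q
    𝟘 𝟙     : Fin q
    isQuasifield : IsQuasifield q _⊕_ _⊙_ ⊖_ 𝟘 𝟙

sumFin : ∀ n → (Fin n → ℕ) → ℕ
sumFin zero    f = 0
sumFin (suc n) f = f Fin.zero + sumFin n (λ i → f (Fin.suc i))

Nγ : ∀ {q} → FiniteQuasifield q → Fin q →
     Subset q → Subset q → Subset q → Subset q → ℕ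
Nγ {q} Q γ A B C D =
  sumFin q λ a → sumFin q λ b → sumFin q λ c → sumFin q λ d →
    if lookup A a ∧ lookup B b ∧ lookup C c ∧ lookup D d
         ∧ ⌊ ((a ⊕ b) ⊕ γ) ≟ (c ⊙ d) ⌋
    then 1 else 0
  where open FiniteQuasifield Q

{-# OPTIONS --safe #-}
module Submission where

-- View (a , d) as a point and (b , c) as the line {(a , d) : a + b + γ = c · d} of slope c. Every
-- line has q points, distinct lines of equal slope are disjoint, and lines of different slopes meet
-- exactly once (the last quasifield axiom). Let w (a , d) count the lines with (b , c) ∈ B × C
-- through (a , d). Then N = Σ_{A×D} w, Σ w = q |B||C|, and counting pairs of lines through each
-- point gives Σ w² = q |B||C| + |B|²|C|² − |B|²|C|. With M = q² + q + 1 and K = (q + 1) |B||C|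
-- this yields Σ (M w − K)² ≤ M² q |B||C|, and Cauchy–Schwarz over A × D bounds
-- (M N − (q + 1) S)² = (Σ_{A×D} (M w − K))² by |A||D| · M² q |B||C| = q S M².

open import Defs
open import Algebra.Bundles using (Monoid; Group)
open import Data.Bool using (Bool; true; false; _∧_; if_then_else_)
open import Data.Fin using (Fin; zero; suc; _↑ˡ_; _↑ʳ_; combine; remQuot)
open import Data.Fin.Properties using (_≟_; remQuot-combine)
open import Data.Fin.Subset using (Subset; ∣_∣)
open import Data.Fin.Subset.Properties using (∣p∣≤n)
open import Data.Product using (_×_; _,_; proj₁; proj₂)
open import Data.Vec using (_∷_; []; lookup)
open import Data.Vec.Functional using (Vector)
open import Function using (_∘_; _⇔_; mk⇔)
open import Level using (0ℓ)
open import Relation.Binary.PropositionalEquality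
open import Relation.Nullary using (yes; no)
open import Relation.Nullary.Decidable using (does; does-⇔; ⌊_⌋; isYes≗does)
import Algebra.Properties.Group as GroupProperties
import Algebra.Properties.Quasigroup as QuasigroupProperties
import Algebra.Properties.Semiring.Sum as SemiringSum
import Data.Nat as ℕ
import Data.Nat.Properties as ℕ
import Data.Integer as ℤ
import Data.Integer.Properties as ℤ

module _ {c ℓ} (M : Monoid c ℓ) where
  open Monoid M using (Carrier; _≈_; _∙_; ∙-congˡ; identityˡ; assoc)
    renaming (refl to ≈-refl; sym to ≈-sym; trans to ≈-trans; reflexive to ≈-reflexive)
  open import Algebra.Properties.Monoid.Sum M

  sum-↑ : ∀ m {n} (f : Vector Carrier (m ℕ.+ n)) →
          sum f ≈ sum (λ i → f (i ↑ˡ n)) ∙ sum (λ j → f (m ↑ʳ j))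
  sum-↑ ℕ.zero    f = ≈-sym (identityˡ _)
  sum-↑ (ℕ.suc m) f = ≈-trans (∙-congˡ (sum-↑ m (f ∘ suc))) (≈-sym (assoc _ _ _))

  sum-combine : ∀ m {n} (f : Vector Carrier (m ℕ.* n)) →
                sum f ≈ ∑[ i < m ] ∑[ j < n ] f (combine i j)
  sum-combine ℕ.zero    f = ≈-refl
  sum-combine (ℕ.suc m) {n} f = ≈-trans (sum-↑ n f) (∙-congˡ (sum-combine m (λ k → f (n ↑ʳ k))))

  sum-remQuot : ∀ m n (g : Fin m × Fin n → Carrier) →
                ∑[ k < m ℕ.* n ] g (remQuot n k) ≈ ∑[ i < m ] ∑[ j < n ] g (i , j)
  sum-remQuot m n g = ≈-trans (sum-combine m _)
    (sum-cong-≋ λ i → sum-cong-≋ λ j → ≈-reflexive (cong g (remQuot-combine i j)))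

module NatSum where
  open import Data.Nat using (ℕ; zero; suc; _+_; _*_; _≤_; z≤n; s≤s)
  open import Data.Nat.Properties using (+-*-semiring; +-identityʳ; m+n≡0⇒m≡0; m+n≡0⇒n≡0)
  open import Data.Nat.Tactic.RingSolver using (solve-∀)
  open SemiringSum +-*-semiring

  χ : Bool → ℕ
  χ b = if b then 1 else 0

  χ-∧ : ∀ x y → χ (x ∧ y) ≡ χ x * χ y
  χ-∧ true  y = sym (+-identityʳ (χ y))
  χ-∧ false y = refl

  χ-idem : ∀ x → χ x * χ x ≡ χ x
  χ-idem true  = refl
  χ-idem false = refl

  χ≤1 : ∀ x → χ x ≤ 1
  χ≤1 true  = s≤s z≤n
  χ≤1 false = z≤n

  χ∈ : ∀ {n} → Subset n → Fin n → ℕ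
  χ∈ p i = χ (lookup p i)

  χ∈-idem : ∀ {n} (p : Subset n) i → χ∈ p i * χ∈ p i ≡ χ∈ p i
  χ∈-idem p i = χ-idem (lookup p i)

  ∣p∣≡∑χ∈ : ∀ {n} (p : Subset n) → ∣ p ∣ ≡ ∑[ i < n ] χ∈ p i
  ∣p∣≡∑χ∈ []          = refl
  ∣p∣≡∑χ∈ (true ∷ p)  = cong suc (∣p∣≡∑χ∈ p)
  ∣p∣≡∑χ∈ (false ∷ p) = ∣p∣≡∑χ∈ p

  sumFin≗sum : ∀ n {f g : Fin n → ℕ} → (∀ i → f i ≡ g i) → sumFin n f ≡ sum g
  sumFin≗sum zero    f≗g = refl
  sumFin≗sum (suc n) f≗g = cong₂ _+_ (f≗g zero) (sumFin≗sum n (f≗g ∘ suc))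

  ∑-const : ∀ n k → ∑[ i < n ] k ≡ n * k
  ∑-const zero    k = refl
  ∑-const (suc n) k = cong (k +_) (∑-const n k)

  ∑≡0⇒≡0 : ∀ {n} (f : Fin n → ℕ) → sum f ≡ 0 → ∀ i → f i ≡ 0
  ∑≡0⇒≡0 f ∑f≡0 zero    = m+n≡0⇒m≡0 (f zero) ∑f≡0
  ∑≡0⇒≡0 f ∑f≡0 (suc i) = ∑≡0⇒≡0 (f ∘ suc) (m+n≡0⇒n≡0 (f zero) ∑f≡0) i

  ∑-δ : ∀ {n} (x : Fin n) (f : Fin n → ℕ) → ∑[ i < n ] (χ (does (i ≟ x)) * f i) ≡ f x
  ∑-δ {suc n} zero    f = trans (cong₂ _+_ (+-identityʳ (f zero)) (sum-replicate-zero n))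
                                (+-identityʳ (f zero))
  ∑-δ {suc n} (suc x) f = ∑-δ x (f ∘ suc)

  ∑*∑ : ∀ {m n} (f : Fin m → ℕ) (g : Fin n → ℕ) →
        (∑[ i < m ] f i) * (∑[ j < n ] g j) ≡ ∑[ i < m ] ∑[ j < n ] (f i * g j)
  ∑*∑ f g = trans (*-distribʳ-sum _ f) (sum-cong-≗ λ i → *-distribˡ-sum (f i) g)

  module _ {n m} (I : Fin n → Fin m → ℕ) (β : Fin m → ℕ) where
    open ≡-Reasoning

    ∑-incidences : ∑[ p < n ] ∑[ l < m ] (β l * I p l) ≡ ∑[ l < m ] (β l * ∑[ p < n ] I p l)
    ∑-incidences = trans (∑-comm (λ p l → β l * I p l))
                         (sum-cong-≗ λ l → sym (*-distribˡ-sum (β l) (λ p → I p l)))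

    ∑-incidences² : ∑[ p < n ] (∑[ l < m ] (β l * I p l) * ∑[ l < m ] (β l * I p l))
                  ≡ ∑[ l < m ] (β l * ∑[ l′ < m ] (β l′ * ∑[ p < n ] (I p l * I p l′)))
    ∑-incidences² = begin
      ∑[ p < n ] (∑[ l < m ] (β l * I p l) * ∑[ l < m ] (β l * I p l))
        ≡⟨ sum-cong-≗ (λ p → ∑*∑ (λ l → β l * I p l) (λ l → β l * I p l)) ⟩
      ∑[ p < n ] ∑[ l < m ] ∑[ l′ < m ] (β l * I p l * (β l′ * I p l′))
        ≡⟨ trans (∑-comm (λ p l → ∑[ l′ < m ] (β l * I p l * (β l′ * I p l′))))
             (sum-cong-≗ λ l → ∑-comm (λ p l′ → β l * I p l * (β l′ * I p l′))) ⟩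
      ∑[ l < m ] ∑[ l′ < m ] ∑[ p < n ] (β l * I p l * (β l′ * I p l′))
        ≡⟨ sum-cong-≗ (λ l → sum-cong-≗ λ l′ → sum-cong-≗ λ p →
             rearrange (β l) (β l′) (I p l) (I p l′)) ⟩
      ∑[ l < m ] ∑[ l′ < m ] ∑[ p < n ] (β l * (β l′ * (I p l * I p l′)))
        ≡⟨ sum-cong-≗ (λ l → sum-cong-≗ λ l′ →
             trans (sym (*-distribˡ-sum (β l) (λ p → β l′ * (I p l * I p l′))))
                   (cong (β l *_) (sym (*-distribˡ-sum (β l′) (λ p → I p l * I p l′))))) ⟩
      ∑[ l < m ] ∑[ l′ < m ] (β l * (β l′ * ∑[ p < n ] (I p l * I p l′)))
        ≡⟨ sum-cong-≗ (λ l → sym (*-distribˡ-sum (β l) λ l′ →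
                                   β l′ * ∑[ p < n ] (I p l * I p l′))) ⟩
      ∑[ l < m ] (β l * ∑[ l′ < m ] (β l′ * ∑[ p < n ] (I p l * I p l′))) ∎
      where
      rearrange : ∀ a b x y → a * x * (b * y) ≡ a * (b * (x * y))
      rearrange = solve-∀

module Incidence {q} (Q : FiniteQuasifield q) (γ : Fin q) where
  open import Data.Nat using (ℕ; _+_; _*_)
  open import Data.Nat.Properties
    using (+-0-monoid; +-*-semiring; *-identityʳ; *-zeroʳ; +-comm; *-comm; *-assoc; *-distribˡ-+)
  open import Data.Nat.Tactic.RingSolver using (solve-∀)
  open SemiringSum +-*-semiring
  open NatSum

  open FiniteQuasifield Q using (_⊕_; _⊙_; isQuasifield)
  open IsQuasifield isQuasifield using (+-isGroup; uniqueSol)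

  +-group : Group 0ℓ 0ℓ
  +-group = record { isGroup = +-isGroup }

  open Group +-group using (_//_; _\\_; assoc)
  open GroupProperties +-group using (quasigroup; //-rightDividesˡ)
  open QuasigroupProperties quasigroup using (x≈z//y; cancelˡ; cancelʳ)

  Point Line : Set
  Point = Fin q × Fin q
  Line  = Fin q × Fin q

  incident : Point → Line → ℕ
  incident (a , d) (b , c) = χ (does (((a ⊕ b) ⊕ γ) ≟ (c ⊙ d)))

  foot : Line → Fin q → Fin q
  foot (b , c) d = (c ⊙ d) // (b ⊕ γ)

  foot-incident : ∀ b c d → (foot (b , c) d ⊕ b) ⊕ γ ≡ c ⊙ d
  foot-incident b c d = trans (assoc _ b γ) (//-rightDividesˡ (b ⊕ γ) (c ⊙ d))

  incident⇔foot : ∀ a b c d → ((a ⊕ b) ⊕ γ ≡ c ⊙ d) ⇔ (a ≡ foot (b , c) d)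
  incident⇔foot a b c d = mk⇔
    (λ eq → x≈z//y a (b ⊕ γ) (c ⊙ d) (trans (sym (assoc a b γ)) eq))
    (λ { refl → foot-incident b c d })

  -- Points and lines are both pairs; summing over them through remQuot turns a pair into a single
  -- index of Fin (q * q), so that single-index lemmas such as ∑-incidences and cauchy-schwarz apply.
  pair : Fin (q * q) → Fin q × Fin q
  pair = remQuot q

  ∑² : (Fin q × Fin q → ℕ) → ℕ
  ∑² f = ∑[ k < q * q ] f (pair k)

  ∑²-split : ∀ f → ∑² f ≡ ∑[ i < q ] ∑[ j < q ] f (i , j)
  ∑²-split = sum-remQuot +-0-monoid q q

  ∑²-incident : ∀ ℓ (g : Point → ℕ) → ∑² (λ p → incident p ℓ * g p) ≡ ∑[ d < q ] g (foot ℓ d , d)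
  ∑²-incident ℓ@(b , c) g = begin
    ∑² (λ p → incident p ℓ * g p)
      ≡⟨ ∑²-split _ ⟩
    ∑[ a < q ] ∑[ d < q ] (incident (a , d) ℓ * g (a , d))
      ≡⟨ ∑-comm (λ a d → incident (a , d) ℓ * g (a , d)) ⟩
    ∑[ d < q ] ∑[ a < q ] (incident (a , d) ℓ * g (a , d))
      ≡⟨ sum-cong-≗ (λ d → trans (sum-cong-≗ λ a → cong (_* g (a , d)) (on-foot a d))
                                 (∑-δ (foot ℓ d) (λ a → g (a , d)))) ⟩
    ∑[ d < q ] g (foot ℓ d , d) ∎
    where
    open ≡-Reasoning
    on-foot : ∀ a d → incident (a , d) ℓ ≡ χ (does (a ≟ foot ℓ d))
    on-foot a d = cong χ (does-⇔ (incident⇔foot a b c d) (((a ⊕ b) ⊕ γ) ≟ (c ⊙ d)) (a ≟ foot ℓ d))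

  line-size : ∀ ℓ → ∑² (λ p → incident p ℓ) ≡ q
  line-size ℓ = begin
    ∑² (λ p → incident p ℓ)      ≡⟨ sum-cong-≗ (λ k → sym (*-identityʳ (incident (pair k) ℓ))) ⟩
    ∑² (λ p → incident p ℓ * 1)  ≡⟨ ∑²-incident ℓ (λ _ → 1) ⟩
    ∑[ d < q ] 1                 ≡⟨ trans (∑-const q 1) (*-identityʳ q) ⟩
    q                            ∎
    where open ≡-Reasoning

  -- Equal lines share q points, distinct parallel lines none, and lines of different slopes one
  -- (uniqueSol); adding the same-slope indicator on the left keeps the statement free of subtraction.
  meet-size : ∀ b c b′ c′ →
              ∑² (λ p → incident p (b , c) * incident p (b′ , c′)) + χ (does (c′ ≟ c))
              ≡ 1 + q * (χ (does (b′ ≟ b)) * χ (does (c′ ≟ c)))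
  meet-size b c b′ c′ with c′ ≟ c
  ... | yes refl = begin
    ∑² (λ p → incident p (b , c) * incident p (b′ , c)) + 1
      ≡⟨ cong (_+ 1) (∑²-incident (b , c) (λ p → incident p (b′ , c))) ⟩
    ∑[ d < q ] incident (foot (b , c) d , d) (b′ , c) + 1
      ≡⟨ cong (_+ 1) (trans (sum-cong-≗ same-slope) (∑-const q _)) ⟩
    q * χ (does (b′ ≟ b)) + 1
      ≡⟨ trans (+-comm _ 1) (cong (λ t → 1 + q * t) (sym (*-identityʳ _))) ⟩
    1 + q * (χ (does (b′ ≟ b)) * 1) ∎
    where
    open ≡-Reasoning
    same-slope : ∀ d → incident (foot (b , c) d , d) (b′ , c) ≡ χ (does (b′ ≟ b))
    same-slope d = cong χ (does-⇔ (mk⇔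
      (λ eq → cancelˡ _ b′ b (cancelʳ γ _ _ (trans eq (sym (foot-incident b c d)))))
      (λ { refl → foot-incident b c d }))
      (((foot (b , c) d ⊕ b′) ⊕ γ) ≟ (c ⊙ d)) (b′ ≟ b))
  ... | no c′≢c = begin
    ∑² (λ p → incident p (b , c) * incident p (b′ , c′)) + 0
      ≡⟨ cong (_+ 0) (∑²-incident (b , c) (λ p → incident p (b′ , c′))) ⟩
    ∑[ d < q ] incident (foot (b , c) d , d) (b′ , c′) + 0
      ≡⟨ cong (_+ 0) (sum-cong-≗ λ d → trans (crossing d) (sym (*-identityʳ _))) ⟩
    ∑[ d < q ] (χ (does (d ≟ d₀)) * 1) + 0
      ≡⟨ cong (_+ 0) (∑-δ d₀ (λ _ → 1)) ⟩
    1 + 0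
      ≡⟨ cong (1 +_) (sym (trans (cong (q *_) (*-zeroʳ (χ (does (b′ ≟ b))))) (*-zeroʳ q))) ⟩
    1 + q * (χ (does (b′ ≟ b)) * 0) ∎
    where
    open ≡-Reasoning
    u = (b ⊕ γ) \\ (b′ ⊕ γ)
    sol = uniqueSol c′ c u c′≢c
    d₀ = proj₁ sol
    shift : ∀ d → (foot (b , c) d ⊕ b′) ⊕ γ ≡ (c ⊙ d) ⊕ u
    shift d = trans (assoc _ b′ γ) (assoc (c ⊙ d) _ (b′ ⊕ γ))
    crossing : ∀ d → incident (foot (b , c) d , d) (b′ , c′) ≡ χ (does (d ≟ d₀))
    crossing d = cong χ (does-⇔ (mk⇔
      (λ eq → proj₂ (proj₂ sol) d (trans (sym eq) (shift d)))
      (λ { refl → trans (shift d₀) (sym (proj₁ (proj₂ sol))) }))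
      (((foot (b , c) d ⊕ b′) ⊕ γ) ≟ (c′ ⊙ d)) (d ≟ d₀))

  module Counting (A B C D : Subset q) where
    open ≡-Reasoning

    β : Line → ℕ
    β (b , c) = χ∈ B b * χ∈ C c

    w : Point → ℕ
    w p = ∑² (λ ℓ → β ℓ * incident p ℓ)

    α : Point → ℕ
    α (a , d) = χ∈ A a * χ∈ D d

    x : ℕ
    x = ∣ B ∣ * ∣ C ∣

    ∑β : ∑² β ≡ x
    ∑β = trans (∑²-split β)
               (sym (trans (cong₂ _*_ (∣p∣≡∑χ∈ B) (∣p∣≡∑χ∈ C)) (∑*∑ (χ∈ B) (χ∈ C))))

    ∑α : ∑² α ≡ ∣ A ∣ * ∣ D ∣
    ∑α = trans (∑²-split α)
               (sym (trans (cong₂ _*_ (∣p∣≡∑χ∈ A) (∣p∣≡∑χ∈ D)) (∑*∑ (χ∈ A) (χ∈ D))))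

    β-idem : ∀ ℓ → β ℓ * β ℓ ≡ β ℓ
    β-idem (b , c) = trans (interchange (χ∈ B b) (χ∈ C c)) (cong₂ _*_ (χ∈-idem B b) (χ∈-idem C c))
      where
      interchange : ∀ m n → m * n * (m * n) ≡ m * m * (n * n)
      interchange = solve-∀

    β-absorbs-slope : ∀ b c → β (b , c) * χ∈ C c ≡ β (b , c)
    β-absorbs-slope b c = trans (*-assoc (χ∈ B b) _ _) (cong (χ∈ B b *_) (χ∈-idem C c))

    ∑β-δ : ∀ b c →
           ∑² (λ (b′ , c′) → β (b′ , c′) * (χ (does (b′ ≟ b)) * χ (does (c′ ≟ c)))) ≡ β (b , c)
    ∑β-δ b c = begin
      ∑² (λ (b′ , c′) → β (b′ , c′) * (δb b′ * δc c′))
        ≡⟨ ∑²-split _ ⟩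
      ∑[ b′ < q ] ∑[ c′ < q ] (β (b′ , c′) * (δb b′ * δc c′))
        ≡⟨ sum-cong-≗ (λ b′ → sum-cong-≗ λ c′ →
             rearrange (χ∈ B b′) (χ∈ C c′) (δb b′) (δc c′)) ⟩
      ∑[ b′ < q ] ∑[ c′ < q ] (δb b′ * (δc c′ * β (b′ , c′)))
        ≡⟨ sum-cong-≗ (λ b′ → sym (*-distribˡ-sum (δb b′) (λ c′ → δc c′ * β (b′ , c′)))) ⟩
      ∑[ b′ < q ] (δb b′ * ∑[ c′ < q ] (δc c′ * β (b′ , c′)))
        ≡⟨ sum-cong-≗ (λ b′ → cong (δb b′ *_) (∑-δ c (λ c′ → β (b′ , c′)))) ⟩
      ∑[ b′ < q ] (δb b′ * β (b′ , c))
        ≡⟨ ∑-δ b (λ b′ → β (b′ , c)) ⟩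
      β (b , c) ∎
      where
      δb δc : Fin q → ℕ
      δb b′ = χ (does (b′ ≟ b))
      δc c′ = χ (does (c′ ≟ c))
      rearrange : ∀ m n s t → m * n * (s * t) ≡ s * (t * (m * n))
      rearrange = solve-∀

    ∑β-slope : ∀ c → ∑² (λ (b′ , c′) → β (b′ , c′) * χ (does (c′ ≟ c))) ≡ ∣ B ∣ * χ∈ C c
    ∑β-slope c = begin
      ∑² (λ (b′ , c′) → β (b′ , c′) * δc c′)
        ≡⟨ ∑²-split _ ⟩
      ∑[ b′ < q ] ∑[ c′ < q ] (β (b′ , c′) * δc c′)
        ≡⟨ sum-cong-≗ (λ b′ → sum-cong-≗ λ c′ → rearrange (χ∈ B b′) (χ∈ C c′) (δc c′)) ⟩
      ∑[ b′ < q ] ∑[ c′ < q ] (χ∈ B b′ * (δc c′ * χ∈ C c′))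
        ≡⟨ sum-cong-≗ (λ b′ → trans (sym (*-distribˡ-sum (χ∈ B b′) (λ c′ → δc c′ * χ∈ C c′)))
                                    (cong (χ∈ B b′ *_) (∑-δ c (χ∈ C)))) ⟩
      ∑[ b′ < q ] (χ∈ B b′ * χ∈ C c)
        ≡⟨ sym (*-distribʳ-sum (χ∈ C c) (χ∈ B)) ⟩
      ∑[ b′ < q ] χ∈ B b′ * χ∈ C c
        ≡⟨ cong (_* χ∈ C c) (sym (∣p∣≡∑χ∈ B)) ⟩
      ∣ B ∣ * χ∈ C c ∎
      where
      δc : Fin q → ℕ
      δc c′ = χ (does (c′ ≟ c))
      rearrange : ∀ m n t → m * n * t ≡ m * (t * n)
      rearrange = solve-∀

    ∑w : ∑² w ≡ q * x
    ∑w = begin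
      ∑² w
        ≡⟨ ∑-incidences (λ k l → incident (pair k) (pair l)) (β ∘ pair) ⟩
      ∑² (λ ℓ → β ℓ * ∑² (λ p → incident p ℓ))
        ≡⟨ sum-cong-≗ (λ k → cong (β (pair k) *_) (line-size _)) ⟩
      ∑² (λ ℓ → β ℓ * q)
        ≡⟨ sym (*-distribʳ-sum q (β ∘ pair)) ⟩
      ∑² β * q
        ≡⟨ trans (cong (_* q) ∑β) (*-comm x q) ⟩
      q * x ∎

    meets : Line → Line → ℕ
    meets ℓ ℓ′ = ∑² (λ p → incident p ℓ * incident p ℓ′)

    ∑-meets : ∀ b c →
              ∑² (λ ℓ′ → β ℓ′ * meets (b , c) ℓ′) + ∣ B ∣ * χ∈ C c ≡ x + q * β (b , c)
    ∑-meets b c = begin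
      ∑² (λ ℓ′ → β ℓ′ * meets (b , c) ℓ′) + ∣ B ∣ * χ∈ C c
        ≡⟨ cong (∑² (λ ℓ′ → β ℓ′ * meets (b , c) ℓ′) +_) (sym (∑β-slope c)) ⟩
      ∑² (λ ℓ′ → β ℓ′ * meets (b , c) ℓ′) + ∑² (λ (b′ , c′) → β (b′ , c′) * δc c′)
        ≡⟨ sym (∑-distrib-+ (λ k → β (pair k) * meets (b , c) (pair k))
                            (λ k → β (pair k) * δc (proj₂ (pair k)))) ⟩
      ∑² (λ (b′ , c′) → β (b′ , c′) * meets (b , c) (b′ , c′) + β (b′ , c′) * δc c′)
        ≡⟨ sum-cong-≗ (λ k → by-meet-size (pair k)) ⟩
      ∑² (λ (b′ , c′) → β (b′ , c′) + q * (β (b′ , c′) * (δb b′ * δc c′)))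
        ≡⟨ ∑-distrib-+ (λ k → β (pair k)) _ ⟩
      ∑² β + ∑² (λ (b′ , c′) → q * (β (b′ , c′) * (δb b′ * δc c′)))
        ≡⟨ cong₂ _+_ ∑β (trans (sym (*-distribˡ-sum q (λ k → β (pair k) * δbc (pair k))))
                               (cong (q *_) (∑β-δ b c))) ⟩
      x + q * β (b , c) ∎
      where
      δb δc : Fin q → ℕ
      δb b′ = χ (does (b′ ≟ b))
      δc c′ = χ (does (c′ ≟ c))
      δbc : Line → ℕ
      δbc (b′ , c′) = δb b′ * δc c′
      by-meet-size : ∀ ℓ′ →
        β ℓ′ * meets (b , c) ℓ′ + β ℓ′ * δc (proj₂ ℓ′) ≡ β ℓ′ + q * (β ℓ′ * δbc ℓ′)
      by-meet-size ℓ′@(b′ , c′) = trans (sym (*-distribˡ-+ (β ℓ′) _ _))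
        (trans (cong (β ℓ′ *_) (meet-size b c b′ c′)) (expand (β ℓ′) q (δbc ℓ′)))
        where
        expand : ∀ m n t → m * (1 + n * t) ≡ m + n * (m * t)
        expand = solve-∀

    ∑w² : ∑² (λ p → w p * w p) + ∣ B ∣ * x ≡ q * x + x * x
    ∑w² = begin
      ∑² (λ p → w p * w p) + ∣ B ∣ * x
        ≡⟨ cong₂ _+_ (∑-incidences² (λ k l → incident (pair k) (pair l)) (β ∘ pair))
                     (sym ∑β-slope-weighted) ⟩
      ∑² (λ ℓ → β ℓ * R ℓ) + ∑² (λ ℓ → β ℓ * (∣ B ∣ * χ∈ C (proj₂ ℓ)))
        ≡⟨ sym (∑-distrib-+ (λ k → β (pair k) * R (pair k)) _) ⟩
      ∑² (λ ℓ → β ℓ * R ℓ + β ℓ * (∣ B ∣ * χ∈ C (proj₂ ℓ)))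
        ≡⟨ sum-cong-≗ (λ k → by-∑-meets (pair k)) ⟩
      ∑² (λ ℓ → x * β ℓ + q * β ℓ)
        ≡⟨ ∑-distrib-+ (λ k → x * β (pair k)) _ ⟩
      ∑² (λ ℓ → x * β ℓ) + ∑² (λ ℓ → q * β ℓ)
        ≡⟨ cong₂ _+_ (trans (sym (*-distribˡ-sum x (β ∘ pair))) (cong (x *_) ∑β))
                     (trans (sym (*-distribˡ-sum q (β ∘ pair))) (cong (q *_) ∑β)) ⟩
      x * x + q * x
        ≡⟨ +-comm (x * x) (q * x) ⟩
      q * x + x * x ∎
      where
      R : Line → ℕ
      R ℓ = ∑² (λ ℓ′ → β ℓ′ * meets ℓ ℓ′)
      ∑β-slope-weighted : ∑² (λ ℓ → β ℓ * (∣ B ∣ * χ∈ C (proj₂ ℓ))) ≡ ∣ B ∣ * x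
      ∑β-slope-weighted = trans (sum-cong-≗ λ k → absorb (pair k))
                                (trans (sym (*-distribˡ-sum ∣ B ∣ (β ∘ pair))) (cong (∣ B ∣ *_) ∑β))
        where
        absorb : ∀ ℓ → β ℓ * (∣ B ∣ * χ∈ C (proj₂ ℓ)) ≡ ∣ B ∣ * β ℓ
        absorb ℓ@(b , c) = trans (*-comm (β ℓ) _) (trans (*-assoc ∣ B ∣ _ _)
                             (cong (∣ B ∣ *_) (trans (*-comm (χ∈ C c) _) (β-absorbs-slope b c))))
      by-∑-meets : ∀ ℓ → β ℓ * R ℓ + β ℓ * (∣ B ∣ * χ∈ C (proj₂ ℓ)) ≡ x * β ℓ + q * β ℓ
      by-∑-meets ℓ@(b , c) = begin
        β ℓ * R ℓ + β ℓ * (∣ B ∣ * χ∈ C c)  ≡⟨ sym (*-distribˡ-+ (β ℓ) _ _) ⟩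
        β ℓ * (R ℓ + ∣ B ∣ * χ∈ C c)        ≡⟨ cong (β ℓ *_) (∑-meets b c) ⟩
        β ℓ * (x + q * β ℓ)                 ≡⟨ expand (β ℓ) x q ⟩
        x * β ℓ + q * (β ℓ * β ℓ)           ≡⟨ cong (λ t → x * β ℓ + q * t) (β-idem ℓ) ⟩
        x * β ℓ + q * β ℓ                   ∎
        where
        expand : ∀ m y n → m * (y + n * m) ≡ y * m + n * (m * m)
        expand = solve-∀

    Nγ≡∑αw : Nγ Q γ A B C D ≡ ∑² (λ p → α p * w p)
    Nγ≡∑αw = begin
      Nγ Q γ A B C D
        ≡⟨ sumFin≗sum q (λ a → sumFin≗sum q λ b → sumFin≗sum q λ c → sumFin≗sum q λ d → refl) ⟩
      ∑[ a < q ] ∑[ b < q ] ∑[ c < q ] ∑[ d < q ] F a b c d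
        ≡⟨ sum-cong-≗ (λ a → trans (sum-cong-≗ λ b → ∑-comm (F a b))
                                   (∑-comm (λ b d → ∑[ c < q ] F a b c d))) ⟩
      ∑[ a < q ] ∑[ d < q ] ∑[ b < q ] ∑[ c < q ] F a b c d
        ≡⟨ sum-cong-≗ (λ a → sum-cong-≗ λ d → ∑∑F a d) ⟩
      ∑[ a < q ] ∑[ d < q ] (α (a , d) * w (a , d))
        ≡⟨ sym (∑²-split (λ p → α p * w p)) ⟩
      ∑² (λ p → α p * w p) ∎
      where
      F : Fin q → Fin q → Fin q → Fin q → ℕ
      F a b c d = χ (lookup A a ∧ lookup B b ∧ lookup C c ∧ lookup D d ∧ ⌊ ((a ⊕ b) ⊕ γ) ≟ (c ⊙ d) ⌋)
      F≡ : ∀ a b c d → F a b c d ≡ α (a , d) * (β (b , c) * incident (a , d) (b , c))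
      F≡ a b c d = begin
        F a b c d
          ≡⟨ trans (χ-∧ (lookup A a) _) (cong (χ∈ A a *_) (trans (χ-∧ (lookup B b) _) (cong (χ∈ B b *_)
               (trans (χ-∧ (lookup C c) _) (cong (χ∈ C c *_) (χ-∧ (lookup D d) _)))))) ⟩
        χ∈ A a * (χ∈ B b * (χ∈ C c * (χ∈ D d * χ ⌊ ((a ⊕ b) ⊕ γ) ≟ (c ⊙ d) ⌋)))
          ≡⟨ cong (λ t → χ∈ A a * (χ∈ B b * (χ∈ C c * (χ∈ D d * χ t)))) (isYes≗does _) ⟩
        χ∈ A a * (χ∈ B b * (χ∈ C c * (χ∈ D d * incident (a , d) (b , c))))
          ≡⟨ rearrange (χ∈ A a) (χ∈ B b) (χ∈ C c) (χ∈ D d) (incident (a , d) (b , c)) ⟩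
        α (a , d) * (β (b , c) * incident (a , d) (b , c)) ∎
        where
        rearrange : ∀ m n s t u → m * (n * (s * (t * u))) ≡ m * t * (n * s * u)
        rearrange = solve-∀
      ∑∑F : ∀ a d → ∑[ b < q ] ∑[ c < q ] F a b c d ≡ α (a , d) * w (a , d)
      ∑∑F a d = begin
        ∑[ b < q ] ∑[ c < q ] F a b c d
          ≡⟨ sum-cong-≗ (λ b → sum-cong-≗ λ c → F≡ a b c d) ⟩
        ∑[ b < q ] ∑[ c < q ] (α (a , d) * G b c)
          ≡⟨ sum-cong-≗ (λ b → sym (*-distribˡ-sum (α (a , d)) (G b))) ⟩
        ∑[ b < q ] (α (a , d) * ∑[ c < q ] G b c)
          ≡⟨ sym (*-distribˡ-sum (α (a , d)) (λ b → ∑[ c < q ] G b c)) ⟩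
        α (a , d) * ∑[ b < q ] ∑[ c < q ] G b c
          ≡⟨ cong (α (a , d) *_) (sym (∑²-split (λ ℓ → β ℓ * incident (a , d) ℓ))) ⟩
        α (a , d) * w (a , d) ∎
        where
        G : Fin q → Fin q → ℕ
        G b c = β (b , c) * incident (a , d) (b , c)

module IntSum where
  open import Data.Nat using (ℕ; zero; suc; z≤n; s≤s)
  open import Data.Integer using (ℤ; +_; -[1+_]; _+_; _*_; _-_; -_; _≤_; 0ℤ; 1ℤ; +≤+)
    renaming (∣_∣ to abs)
  open import Data.Integer.Properties
  open import Data.Integer.Tactic.RingSolver using (solve-∀)
  open SemiringSum +-*-semiring
  open NatSum using (∑≡0⇒≡0)
  module ℕΣ = SemiringSum ℕ.+-*-semiring

  ∑-cast : ∀ {n} (f : Fin n → ℕ) → + (ℕΣ.sum f) ≡ ∑[ i < n ] (+ f i)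
  ∑-cast {zero}  f = refl
  ∑-cast {suc n} f = trans (pos-+ (f zero) _) (cong (_+_ (+ f zero)) (∑-cast (f ∘ suc)))

  ∑-mono-≤ : ∀ {n} {f g : Fin n → ℤ} → (∀ i → f i ≤ g i) → sum f ≤ sum g
  ∑-mono-≤ {zero}  f≤g = ≤-refl
  ∑-mono-≤ {suc n} f≤g = +-mono-≤ (f≤g zero) (∑-mono-≤ (f≤g ∘ suc))

  ∑-linear₂ : ∀ {n} a b (f g : Fin n → ℤ) →
              ∑[ i < n ] (a * f i + b * g i) ≡ a * sum f + b * sum g
  ∑-linear₂ a b f g = trans (∑-distrib-+ (λ i → a * f i) (λ i → b * g i))
                            (sym (cong₂ _+_ (*-distribˡ-sum a f) (*-distribˡ-sum b g)))

  ∑-linear₃ : ∀ {n} a b c (f g h : Fin n → ℤ) →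
              ∑[ i < n ] (a * f i + b * g i + c * h i) ≡ a * sum f + b * sum g + c * sum h
  ∑-linear₃ a b c f g h = trans (∑-distrib-+ (λ i → a * f i + b * g i) (λ i → c * h i))
                                (cong₂ _+_ (∑-linear₂ a b f g) (sym (*-distribˡ-sum c h)))

  +∣i∣*∣i∣≡i*i : ∀ i → + (abs i ℕ.* abs i) ≡ i * i
  +∣i∣*∣i∣≡i*i (+ n)    = pos-* n n
  +∣i∣*∣i∣≡i*i -[1+ n ] = refl

  ∑-weighted-squares-nonNeg : ∀ {n} (e : Fin n → ℕ) (y : Fin n → ℤ) →
                              0ℤ ≤ ∑[ i < n ] (+ e i * (y i * y i))
  ∑-weighted-squares-nonNeg e y = subst (0ℤ ≤_) cast (+≤+ z≤n)
    where
    e*∣y∣² : Fin _ → ℕ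
    e*∣y∣² i = e i ℕ.* (abs (y i) ℕ.* abs (y i))
    cast : + (ℕΣ.sum e*∣y∣²) ≡ ∑[ i < _ ] (+ e i * (y i * y i))
    cast = trans (∑-cast e*∣y∣²) (sum-cong-≗ λ i →
             trans (pos-* (e i) _) (cong (+ e i *_) (+∣i∣*∣i∣≡i*i (y i))))

  module _ {n} (e : Fin n → ℕ) (W : Fin n → ℤ) where
    private
      s Q : ℤ
      s = ∑[ i < n ] (+ e i * W i)
      Q = ∑[ i < n ] (+ e i * (W i * W i))

    ∑-weighted-deviation : ∀ k → ∑[ i < n ] (+ e i) ≡ k →
      ∑[ i < n ] (+ e i * ((k * W i - s) * (k * W i - s))) ≡ k * (k * Q - s * s)
    ∑-weighted-deviation k ∑e≡k = begin
      ∑[ i < n ] (+ e i * ((k * W i - s) * (k * W i - s)))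
        ≡⟨ sum-cong-≗ (λ i → expand (+ e i) (W i) k s) ⟩
      ∑[ i < n ] (k * k * (+ e i * (W i * W i)) + - (+ 2 * k * s) * (+ e i * W i) + s * s * (+ e i))
        ≡⟨ ∑-linear₃ (k * k) (- (+ 2 * k * s)) (s * s)
                     (λ i → + e i * (W i * W i)) (λ i → + e i * W i) (λ i → + e i) ⟩
      k * k * Q + - (+ 2 * k * s) * s + s * s * ∑[ i < n ] (+ e i)
        ≡⟨ cong (λ t → k * k * Q + - (+ 2 * k * s) * s + s * s * t) ∑e≡k ⟩
      k * k * Q + - (+ 2 * k * s) * s + s * s * k
        ≡⟨ collect k Q s ⟩
      k * (k * Q - s * s) ∎
      where
      open ≡-Reasoning
      expand : ∀ ε w k s → ε * ((k * w - s) * (k * w - s))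
                           ≡ k * k * (ε * (w * w)) + - (+ 2 * k * s) * (ε * w) + s * s * ε
      expand = solve-∀
      collect : ∀ k Q s → k * k * Q + - (+ 2 * k * s) * s + s * s * k ≡ k * (k * Q - s * s)
      collect = solve-∀

    cauchy-schwarz : s * s ≤ + (ℕΣ.sum e) * Q
    cauchy-schwarz with ℕΣ.sum e in ∑e≡
    ... | zero  = ≤-reflexive (trans (cong (λ t → t * t) s≡0) (sym (*-zeroˡ Q)))
      where
      s≡0 : s ≡ 0ℤ
      s≡0 = trans (sum-cong-≗ λ i → cong (λ t → + t * W i) (∑≡0⇒≡0 e ∑e≡ i)) (sum-replicate-zero n)
    ... | suc m = 0≤i-j⇒j≤i (*-cancelˡ-≤-pos 0ℤ (k * Q - s * s) k
                                            (subst (_≤ k * (k * Q - s * s)) (sym (*-zeroʳ k)) 0≤k[kQ-s²]))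
      where
      k = + suc m
      0≤k[kQ-s²] : 0ℤ ≤ k * (k * Q - s * s)
      0≤k[kQ-s²] = subst (0ℤ ≤_) (∑-weighted-deviation k (trans (sym (∑-cast e)) (cong +_ ∑e≡)))
                         (∑-weighted-squares-nonNeg e (λ i → k * W i - s))

  i*i≥0 : ∀ i → 0ℤ ≤ i * i
  i*i≥0 i = subst (0ℤ ≤_) (+∣i∣*∣i∣≡i*i i) (+≤+ z≤n)

  ∑-restrict-≤ : ∀ {n} (e : Fin n → ℕ) (y : Fin n → ℤ) → (∀ i → e i ℕ.≤ 1) →
                 ∑[ i < n ] (+ e i * (y i * y i)) ≤ ∑[ i < n ] (y i * y i)
  ∑-restrict-≤ e y e≤1 = ∑-mono-≤ λ i → scale-≤ (e≤1 i) (i*i≥0 (y i))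
    where
    scale-≤ : ∀ {m t} → m ℕ.≤ 1 → 0ℤ ≤ t → + m * t ≤ t
    scale-≤ z≤n       0≤t = 0≤t
    scale-≤ (s≤s z≤n) 0≤t = ≤-reflexive (*-identityˡ _)

  ∑-ones : ∀ n → ∑[ i < n ] 1ℤ ≡ + n
  ∑-ones zero    = refl
  ∑-ones (suc n) = cong (_+_ 1ℤ) (∑-ones n)

  ∑-square-affine : ∀ {n} a b (f : Fin n → ℤ) →
    ∑[ i < n ] ((a * f i - b) * (a * f i - b))
    ≡ a * a * ∑[ i < n ] (f i * f i) - + 2 * a * b * sum f + b * b * + n
  ∑-square-affine {n} a b f = begin
    ∑[ i < n ] ((a * f i - b) * (a * f i - b))
      ≡⟨ sum-cong-≗ (λ i → expand a b (f i)) ⟩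
    ∑[ i < n ] (a * a * (f i * f i) + - (+ 2 * a * b) * f i + b * b * 1ℤ)
      ≡⟨ ∑-linear₃ (a * a) (- (+ 2 * a * b)) (b * b) (λ i → f i * f i) f (λ _ → 1ℤ) ⟩
    a * a * ∑[ i < n ] (f i * f i) + - (+ 2 * a * b) * sum f + b * b * ∑[ i < n ] 1ℤ
      ≡⟨ cong (λ t → a * a * ∑[ i < n ] (f i * f i) + - (+ 2 * a * b) * sum f + b * b * t) (∑-ones n) ⟩
    a * a * ∑[ i < n ] (f i * f i) + - (+ 2 * a * b) * sum f + b * b * + n
      ≡⟨ collect (a * a * ∑[ i < n ] (f i * f i)) (+ 2 * a * b) (sum f) (b * b * + n) ⟩
    a * a * ∑[ i < n ] (f i * f i) - + 2 * a * b * sum f + b * b * + n ∎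
    where
    open ≡-Reasoning
    expand : ∀ a b y → (a * y - b) * (a * y - b) ≡ a * a * (y * y) + - (+ 2 * a * b) * y + b * b * 1ℤ
    expand = solve-∀
    collect : ∀ u c y v → u + - c * y + v ≡ u - c * y + v
    collect = solve-∀

module Estimate {q} (Q : FiniteQuasifield q) (γ : Fin q) (A B C D : Subset q) where
  open import Data.Nat using (ℕ)
  open import Data.Integer using (ℤ; +_; _+_; _*_; _-_; -_; _≤_; 0ℤ; 1ℤ; +≤+)
  open import Data.Integer.Properties
  open import Data.Integer.Tactic.RingSolver using (solve-∀)
  import Data.Nat.Tactic.RingSolver as ℕ-Solver
  open SemiringSum +-*-semiring
  open NatSum using (χ≤1)
  open IntSum
  open Incidence Q γ
  open Counting A B C D

  M K S : ℕ
  M = q ℕ.* q ℕ.+ q ℕ.+ 1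
  K = (q ℕ.+ 1) ℕ.* x
  S = ∣ A ∣ ℕ.* ∣ B ∣ ℕ.* ∣ C ∣ ℕ.* ∣ D ∣

  weight : Fin (q ℕ.* q) → ℕ
  weight = α ∘ pair

  deviation : Fin (q ℕ.* q) → ℤ
  deviation k = + M * + w (pair k) - + K

  discrepancy weighted-deviation weighted-second-moment second-moment : ℤ
  discrepancy            = + (Nγ Q γ A B C D ℕ.* M) - + ((q ℕ.+ 1) ℕ.* S)
  weighted-deviation     = ∑[ k < q ℕ.* q ] (+ weight k * deviation k)
  weighted-second-moment = ∑[ k < q ℕ.* q ] (+ weight k * (deviation k * deviation k))
  second-moment          = ∑[ k < q ℕ.* q ] (deviation k * deviation k)

  weight≤1 : ∀ k → weight k ℕ.≤ 1
  weight≤1 k = ℕ.*-mono-≤ (χ≤1 (lookup A _)) (χ≤1 (lookup D _))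

  discrepancy≡weighted-deviation : discrepancy ≡ weighted-deviation
  discrepancy≡weighted-deviation = begin
    + (Nγ Q γ A B C D ℕ.* M) - + ((q ℕ.+ 1) ℕ.* S)
      ≡⟨ cong₂ _-_ (trans (pos-* (Nγ Q γ A B C D) M) (*-comm (+ Nγ Q γ A B C D) (+ M)))
                   (trans (cong +_ (factor q (∣ A ∣) (∣ B ∣) (∣ C ∣) (∣ D ∣)))
                          (pos-* K (∣ A ∣ ℕ.* ∣ D ∣))) ⟩
    + M * + Nγ Q γ A B C D - + K * + (∣ A ∣ ℕ.* ∣ D ∣)
      ≡⟨ cong₂ (λ n t → + M * n - + K * t) (sym ∑αw) (sym ∑α′) ⟩
    + M * ∑[ k < q ℕ.* q ] (+ weight k * + w (pair k)) - + K * ∑[ k < q ℕ.* q ] (+ weight k)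
      ≡⟨ cong (_+_ (+ M * ∑[ k < q ℕ.* q ] (+ weight k * + w (pair k)))) (neg-distribˡ-* (+ K) _) ⟩
    + M * ∑[ k < q ℕ.* q ] (+ weight k * + w (pair k)) + - + K * ∑[ k < q ℕ.* q ] (+ weight k)
      ≡⟨ sym (∑-linear₂ (+ M) (- + K) (λ k → + weight k * + w (pair k)) (λ k → + weight k)) ⟩
    ∑[ k < q ℕ.* q ] (+ M * (+ weight k * + w (pair k)) + - + K * + weight k)
      ≡⟨ sum-cong-≗ (λ k → sym (distribute (+ weight k) (+ M) (+ w (pair k)) (+ K))) ⟩
    weighted-deviation ∎
    where
    open ≡-Reasoning
    factor : ∀ q a b c d →
             (q ℕ.+ 1) ℕ.* (a ℕ.* b ℕ.* c ℕ.* d) ≡ (q ℕ.+ 1) ℕ.* (b ℕ.* c) ℕ.* (a ℕ.* d)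
    factor = ℕ-Solver.solve-∀
    distribute : ∀ ε m y c → ε * (m * y - c) ≡ m * (ε * y) + - c * ε
    distribute = solve-∀
    ∑αw : ∑[ k < q ℕ.* q ] (+ weight k * + w (pair k)) ≡ + Nγ Q γ A B C D
    ∑αw = trans (sum-cong-≗ λ k → sym (pos-* (weight k) (w (pair k))))
                (trans (sym (∑-cast (λ k → weight k ℕ.* w (pair k)))) (cong +_ (sym Nγ≡∑αw)))
    ∑α′ : ∑[ k < q ℕ.* q ] (+ weight k) ≡ + (∣ A ∣ ℕ.* ∣ D ∣)
    ∑α′ = trans (sym (∑-cast weight)) (cong +_ ∑α)

  -- Centring at K / M rather than at the mean x / q of w leaves x * x behind, with coefficient exactly
  -- 1 because (M − q (q + 1))² = 1.
  second-moment≡ : second-moment ≡ + M * + M * (+ q * + x) + (+ x * + x - + M * + M * (+ ∣ B ∣ * + x))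
  second-moment≡ = begin
    second-moment
      ≡⟨ ∑-square-affine (+ M) (+ K) (+_ ∘ w ∘ pair) ⟩
    + M * + M * ∑[ k < q ℕ.* q ] (+ w (pair k) * + w (pair k)) - + 2 * + M * + K * sum (+_ ∘ w ∘ pair)
      + + K * + K * + (q ℕ.* q)
      ≡⟨ cong₂ (λ s t → + M * + M * s - + 2 * + M * + K * t + + K * + K * + (q ℕ.* q))
               ∑w²-cast ∑w-cast ⟩
    + M * + M * Σw² - + 2 * + M * + K * (+ q * + x) + + K * + K * + (q ℕ.* q)
      ≡⟨ expand-M-K +M≡ +K≡ (pos-* q q) ⟩
    + M * + M * (+ q * + x) + (+ x * + x - + M * + M * (+ ∣ B ∣ * + x)) ∎
    where
    open ≡-Reasoning
    Σw² : ℤ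
    Σw² = + ∑² (λ p → w p ℕ.* w p)
    ∑w²-cast : ∑[ k < q ℕ.* q ] (+ w (pair k) * + w (pair k)) ≡ Σw²
    ∑w²-cast = trans (sum-cong-≗ λ k → sym (pos-* (w (pair k)) (w (pair k))))
                     (sym (∑-cast (λ k → w (pair k) ℕ.* w (pair k))))
    ∑w-cast : sum (+_ ∘ w ∘ pair) ≡ + q * + x
    ∑w-cast = trans (sym (∑-cast (w ∘ pair))) (trans (cong +_ ∑w) (pos-* q x))
    Σw²+∣B∣x : Σw² + + ∣ B ∣ * + x ≡ + q * + x + + x * + x
    Σw²+∣B∣x = trans (cong (_+_ Σw²) (sym (pos-* ∣ B ∣ x)))
              (trans (sym (pos-+ _ (∣ B ∣ ℕ.* x)))
              (trans (cong +_ ∑w²) (trans (pos-+ (q ℕ.* x) _) (cong₂ _+_ (pos-* q x) (pos-* x x)))))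
    +M≡ : + M ≡ + q * + q + + q + 1ℤ
    +M≡ = trans (pos-+ (q ℕ.* q ℕ.+ q) 1)
                (cong (_+ 1ℤ) (trans (pos-+ (q ℕ.* q) q) (cong (_+ + q) (pos-* q q))))
    +K≡ : + K ≡ (+ q + 1ℤ) * + x
    +K≡ = trans (pos-* (q ℕ.+ 1) x) (cong (_* + x) (pos-+ q 1))
    expand-M-K : ∀ {m k qq} → m ≡ + q * + q + + q + 1ℤ → k ≡ (+ q + 1ℤ) * + x → qq ≡ + q * + q →
      m * m * Σw² - + 2 * m * k * (+ q * + x) + k * k * qq
      ≡ m * m * (+ q * + x) + (+ x * + x - m * m * (+ ∣ B ∣ * + x))
    expand-M-K refl refl refl =
      trans (split (+ q) (+ x) (+ ∣ B ∣) Σw²)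
            (trans (cong (λ t → m * m * t + rest) Σw²+∣B∣x) (finish (+ q) (+ x) (+ ∣ B ∣)))
      where
      m = + q * + q + + q + 1ℤ
      k = (+ q + 1ℤ) * + x
      rest = - (+ 2 * m * k * (+ q * + x)) + k * k * (+ q * + q) - m * m * (+ ∣ B ∣ * + x)
      split : ∀ q x b s → let m = q * q + q + 1ℤ ; k = (q + 1ℤ) * x in
        m * m * s - + 2 * m * k * (q * x) + k * k * (q * q)
        ≡ m * m * (s + b * x) + (- (+ 2 * m * k * (q * x)) + k * k * (q * q) - m * m * (b * x))
      split = solve-∀
      finish : ∀ q x b → let m = q * q + q + 1ℤ ; k = (q + 1ℤ) * x in
        m * m * (q * x + x * x) + (- (+ 2 * m * k * (q * x)) + k * k * (q * q) - m * m * (b * x))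
        ≡ m * m * (q * x) + (x * x - m * m * (b * x))
      finish = solve-∀

  x*x≤M*M*[∣B∣*x] : x ℕ.* x ℕ.≤ M ℕ.* M ℕ.* (∣ B ∣ ℕ.* x)
  x*x≤M*M*[∣B∣*x] = ℕ.≤-trans (ℕ.*-monoˡ-≤ x (ℕ.*-monoʳ-≤ ∣ B ∣ ∣C∣≤M*M))
                              (ℕ.≤-reflexive (reassociate ∣ B ∣ (M ℕ.* M) x))
    where
    1≤M : 1 ℕ.≤ M
    1≤M = ℕ.m≤n+m 1 (q ℕ.* q ℕ.+ q)
    q≤M : q ℕ.≤ M
    q≤M = ℕ.≤-trans (ℕ.m≤n+m q (q ℕ.* q)) (ℕ.m≤m+n _ 1)
    ∣C∣≤M*M : ∣ C ∣ ℕ.≤ M ℕ.* M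
    ∣C∣≤M*M = ℕ.≤-trans (∣p∣≤n C) (ℕ.≤-trans q≤M (ℕ.m≤m*n M M {{ℕ.>-nonZero 1≤M}}))
    reassociate : ∀ b m y → b ℕ.* m ℕ.* y ≡ m ℕ.* (b ℕ.* y)
    reassociate = ℕ-Solver.solve-∀

  second-moment-≤ : second-moment ≤ + M * + M * (+ q * + x)
  second-moment-≤ = begin
    second-moment
      ≡⟨ second-moment≡ ⟩
    + M * + M * (+ q * + x) + (+ x * + x - + M * + M * (+ ∣ B ∣ * + x))
      ≤⟨ +-monoʳ-≤ (+ M * + M * (+ q * + x)) (i≤j⇒i-j≤0 x*x≤) ⟩
    + M * + M * (+ q * + x) + 0ℤ
      ≡⟨ +-identityʳ _ ⟩
    + M * + M * (+ q * + x) ∎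
    where
    open ≤-Reasoning
    x*x≤ : + x * + x ≤ + M * + M * (+ ∣ B ∣ * + x)
    x*x≤ = subst₂ _≤_ (pos-* x x) (trans (pos-* (M ℕ.* M) _) (cong₂ _*_ (pos-* M M) (pos-* ∣ B ∣ x)))
                  (+≤+ x*x≤M*M*[∣B∣*x])

  ∑α*M²qx≡qSM² : + ∑² α * (+ M * + M * (+ q * + x)) ≡ + (q ℕ.* S ℕ.* (M ℕ.* M))
  ∑α*M²qx≡qSM² = begin
    + ∑² α * (+ M * + M * (+ q * + x))
      ≡⟨ cong₂ _*_ (cong +_ ∑α) (cong₂ _*_ (sym (pos-* M M)) (sym (pos-* q x))) ⟩
    + (∣ A ∣ ℕ.* ∣ D ∣) * (+ (M ℕ.* M) * + (q ℕ.* x))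
      ≡⟨ cong (+ (∣ A ∣ ℕ.* ∣ D ∣) *_) (sym (pos-* (M ℕ.* M) _)) ⟩
    + (∣ A ∣ ℕ.* ∣ D ∣) * + (M ℕ.* M ℕ.* (q ℕ.* x))
      ≡⟨ sym (pos-* (∣ A ∣ ℕ.* ∣ D ∣) _) ⟩
    + (∣ A ∣ ℕ.* ∣ D ∣ ℕ.* (M ℕ.* M ℕ.* (q ℕ.* x)))
      ≡⟨ cong +_ (regroup (∣ A ∣) (∣ B ∣) (∣ C ∣) (∣ D ∣) q M) ⟩
    + (q ℕ.* S ℕ.* (M ℕ.* M)) ∎
    where
    open ≡-Reasoning
    regroup : ∀ a b c d q m →
              a ℕ.* d ℕ.* (m ℕ.* m ℕ.* (q ℕ.* (b ℕ.* c))) ≡ q ℕ.* (a ℕ.* b ℕ.* c ℕ.* d) ℕ.* (m ℕ.* m)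
    regroup = ℕ-Solver.solve-∀

open import Data.Nat using (ℕ; _+_; _*_; _≤_)
open import Data.Integer using (+_; _-_) renaming (∣_∣ to abs)

theorem1p9 : (q : ℕ) (Q : FiniteQuasifield q) (A B C D : Subset q) (γ : Fin q) →
    let S = ∣ A ∣ * ∣ B ∣ * ∣ C ∣ * ∣ D ∣
        M = q * q + q + 1
        δ = abs (+ (Nγ Q γ A B C D * M) - + ((q + 1) * S))
    in δ * δ ≤ q * S * (M * M)
theorem1p9 q Q A B C D γ = ℤ.drop‿+≤+ (begin
  + (abs discrepancy * abs discrepancy)
    ≡⟨ +∣i∣*∣i∣≡i*i discrepancy ⟩
  discrepancy ℤ.* discrepancy
    ≡⟨ cong (λ t → t ℤ.* t) discrepancy≡weighted-deviation ⟩
  weighted-deviation ℤ.* weighted-deviation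
    ≤⟨ cauchy-schwarz weight deviation ⟩
  + ∑² α ℤ.* weighted-second-moment
    ≤⟨ ℤ.*-monoˡ-≤-nonNeg (+ ∑² α) (∑-restrict-≤ weight deviation weight≤1) ⟩
  + ∑² α ℤ.* second-moment
    ≤⟨ ℤ.*-monoˡ-≤-nonNeg (+ ∑² α) second-moment-≤ ⟩
  + ∑² α ℤ.* (+ M ℤ.* + M ℤ.* (+ q ℤ.* + x))
    ≡⟨ ∑α*M²qx≡qSM² ⟩
  + (q * S * (M * M)) ∎)
  where
  open Estimate Q γ A B C D
  open Incidence Q γ using (∑²)
  open Incidence.Counting Q γ A B C D using (α; x)
  open IntSum using (+∣i∣*∣i∣≡i*i; cauchy-schwarz; ∑-restrict-≤)
  open ℤ.≤-Reasoning
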